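{- Let $M$ be an antisymmetric matroid on $E=[n]\cup[n]^*$ and $\mathcal{G}_M$ its transversal basis graph. Then (i) $\mathrm{dist}_M(B,B')=|B\setminus B'|$ for all vertices $B,B'$ of $\mathcal{G}_M$; and (ii) every cycle $C$ in $\mathcal{G}_M$ has even weight $\eta(C)=\sum_{e\in E(C)}\eta(e)$.
   Context: $E=[n]\cup[n]^*$ with involution $i\leftrightarrow i^*$; a skew pair is $\{i,i^*\}$; $\mathcal{T}_n$ (transversals) are $n$-subsets of $E$ with no skew pair, $\mathcal{A}_n$ (almost-transversals) $n$-subsets with exactly one skew pair. An antisymmetric matroid on $E$ is $(E,\mathcal{B})$ with $\mathcal{B}\subseteq\mathcal{T}_n\cup\mathcal{A}_n$ satisfying (B1) $\mathcal{B}\ne\emptyset$; (B2) for $T\in\mathcal{T}_n$ and distinct skew pairs $p,q$, $(T\cup p)\setminus q\in\mathcal{B}$ iff $(T\cup q)\setminus p\in\mathcal{B}$; (Exch) for $B,B'\in\mathcal{B}$ and $e\in B\setminus B'$ with $B\setminus\{e\}$ having no skew pair and $B'\cup\{e\}$ having exactly one skew pair, there is $f\in B'\setminus B$ with both $(B\setminus\{e\})\cup\{f\}$ and $(B'\cup\{e\})\setminus\{f\}$ in $\mathcal{B}$. The transversal basis graph $\mathcal{G}_M$ has vertex set $\mathcal{B}\cap\mathcal{T}_n$, and $B\ne B'$ are adjacent iff either $|B\setminus B'|=1$, or $|B\setminus B'|=2$ and there is $A\in\mathcal{B}\cap\mathcal{A}_n$ with $|B\setminus A|=|B'\setminus A|=1$.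 An edge $BB'$ has weight $\eta(BB')=|B\setminus B'|$. $\mathrm{dist}_M(B,B')$ is the minimum total weight of a path from $B$ to $B'$ in $\mathcal{G}_M$. -}

module Defs where

open import Data.Nat using (ℕ; zero; suc; _+_; _≤_)
open import Data.Bool using (Bool; true; false)
open import Data.Fin using (Fin)
open import Data.Fin.Subset using (Subset; ⁅_⁆; _∪_; _∩_; _─_; _-_; ∣_∣)
import Data.Fin.Subset as FS
open import Data.Product using (Σ; ∃; _×_; _,_)
open import Data.Sum using (_⊎_)
open import Data.List using (List; []; _∷_)
open import Data.List.Relation.Unary.Unique.Propositional using (Unique)
open import Relation.Binary.PropositionalEquality using (_≡_; _≢_)
open import Relation.Nullary using (¬_)
open import Function.Bundles using (_⇔_)

-- Ground set E = [n] ∪ [n]*.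
-- An element is (i , b) with i : Fin n; b = false means i, b = true means i*.
-- The involution is (i , b) ↦ (i , not b); the skew pair indexed by i is {i, i*}.

Elem : ℕ → Set
Elem n = Fin n × Bool

-- A subset S of E is a pair (P , Q) of subsets of [n]:
-- P = {i | i ∈ S}, Q = {i | i* ∈ S}.
Sub : ℕ → Set
Sub n = Subset n × Subset n

module _ {n : ℕ} where

  infix 4 _∈E_ _∉E_

  _∈E_ : Elem n → Sub n → Set
  (i , false) ∈E (P , Q) = i FS.∈ P
  (i , true)  ∈E (P , Q) = i FS.∈ Q

  _∉E_ : Elem n → Sub n → Set
  e ∉E S = ¬ (e ∈E S)

  size : Sub n → ℕ
  size (P , Q) = ∣ P ∣ + ∣ Q ∣

  skews : Sub n → ℕ
  skews (P , Q) = ∣ P ∩ Q ∣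

  _∖_ : Sub n → Sub n → Sub n
  (P , Q) ∖ (P' , Q') = (P ─ P') , (Q ─ Q')

  addE : Elem n → Sub n → Sub n
  addE (i , false) (P , Q) = (P ∪ ⁅ i ⁆) , Q
  addE (i , true)  (P , Q) = P , (Q ∪ ⁅ i ⁆)

  delE : Elem n → Sub n → Sub n
  delE (i , false) (P , Q) = (P - i) , Q
  delE (i , true)  (P , Q) = P , (Q - i)

  addPair : Fin n → Sub n → Sub n
  addPair i (P , Q) = (P ∪ ⁅ i ⁆) , (Q ∪ ⁅ i ⁆)

  delPair : Fin n → Sub n → Sub n
  delPair i (P , Q) = (P - i) , (Q - i)

IsTransversal : (n : ℕ) → Sub n → Set
IsTransversal n S = size S ≡ n × skews S ≡ 0

IsAlmostTransversal : (n : ℕ) → Sub n → Set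
IsAlmostTransversal n S = size S ≡ n × skews S ≡ 1

record AntisymmetricMatroid (n : ℕ) : Set where
  field
    𝓑 : Sub n → Bool

  IsBasis : Sub n → Set
  IsBasis S = 𝓑 S ≡ true

  field
    bases-shape : ∀ S → IsBasis S → IsTransversal n S ⊎ IsAlmostTransversal n S
    B1 : ∃ λ S → IsBasis S
    B2 : ∀ T → IsTransversal n T → ∀ (p q : Fin n) → p ≢ q →
         IsBasis (delPair q (addPair p T)) ⇔ IsBasis (delPair p (addPair q T))
    Exch : ∀ B B' → IsBasis B → IsBasis B' → ∀ (e : Elem n) →
           e ∈E B → e ∉E B' →
           skews (delE e B) ≡ 0 → skews (addE e B') ≡ 1 →
           Σ (Elem n) λ f → f ∈E B' × f ∉E B ×
             IsBasis (addE f (delE e B)) × IsBasis (delE f (addE e B'))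

module _ {n : ℕ} (M : AntisymmetricMatroid n) where
  open AntisymmetricMatroid M

  Vertex : Sub n → Set
  Vertex B = IsBasis B × IsTransversal n B

  Adjacent : Sub n → Sub n → Set
  Adjacent B B' =
    Vertex B × Vertex B' × B ≢ B' ×
    (size (B ∖ B') ≡ 1 ⊎
     (size (B ∖ B') ≡ 2 ×
      Σ (Sub n) λ A → IsBasis A × IsAlmostTransversal n A ×
                      size (B ∖ A) ≡ 1 × size (B' ∖ A) ≡ 1))

  η : Sub n → Sub n → ℕ
  η B B' = size (B ∖ B')

  data Walk : Sub n → Sub n → Set where
    [_]  : ∀ {B} → Vertex B → Walk B B
    _∷_ : ∀ {B C D} → Adjacent B C → Walk C D → Walk B D

  weight : ∀ {B D} → Walk B D → ℕ
  weight [ _ ] = 0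
  weight (_∷_ {B} {C} _ w) = η B C + weight w

  len : ∀ {B D} → Walk B D → ℕ
  len [ _ ] = 0
  len (_ ∷ w) = suc (len w)

  vertices : ∀ {B D} → Walk B D → List (Sub n)
  vertices ([_] {B} _) = B ∷ []
  vertices (_∷_ {B} _ w) = B ∷ vertices w

  tailVertices : ∀ {B D} → Walk B D → List (Sub n)
  tailVertices [ _ ] = []
  tailVertices (_ ∷ w) = vertices w

  IsPath : ∀ {B D} → Walk B D → Set
  IsPath w = Unique (vertices w)

  IsCycle : ∀ {B} → Walk B B → Set
  IsCycle w = 3 ≤ len w × Unique (tailVertices w)

  IsDist : Sub n → Sub n → ℕ → Set
  IsDist B B' d =
    (Σ (Walk B B') λ w → IsPath w × weight w ≡ d) ×
    (∀ (w : Walk B B') → IsPath w → d ≤ weight w)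

{-# OPTIONS --safe #-}
module Submission where

-- Write tr s for the transversal whose sign vector is s.  Then |tr s ∖ tr t| is the Hamming
-- distance of s and t, which has the parity of |s| + |t|; summing over the edges of a closed
-- walk gives (ii).  For (i), the triangle inequality for set difference bounds the weight of
-- every walk from below.  Conversely, if tr s ≠ tr s' are bases, exchanging an element of
-- tr s ∖ tr s' either flips one sign of s towards s', or produces an almost-transversal
-- basis A; by (B2) its mirror image A' is a basis too, and exchanging between A and A'
-- yields a transversal basis at distance 1 or 2 from tr s, adjacent to it (through A in
-- the second case).  Either way the new sign vector lies between s and s' in the
-- hypercube, so the distance to s' drops by exactly the weight of the edge.  Iterating
-- gives a walk of weight |tr s ∖ tr s'|, which is a path because the distance to the
-- target strictly decreases along it.

open import Defs
open import Data.Nat using (ℕ)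
open import Data.Nat.Divisibility using (_∣_)
open import Data.Product using (_×_)

open import Data.Bool using (Bool; true; false; not; _∧_; _xor_)
import Data.Bool as Bool
open import Data.Bool.Properties
  using (∨-zeroʳ; ∨-identityʳ; ∧-zeroʳ; ∧-identityʳ; ∧-inverseʳ; xor-same; ¬-not)
open import Data.Fin using (Fin; zero; suc)
open import Data.Fin.Properties using (_≟_; ¬∀⟶∃¬) renaming (suc-injective to suc-injectiveᶠ)
open import Data.Fin.Subset using (Subset; ⊥; ∁; ⁅_⁆; _∪_; _∩_; _─_; _-_; ∣_∣)
open import Data.Fin.Subset.Properties
  using (∣⊥∣≡0; ∣p∣≤n; ∣∁p∣≡n∸∣p∣; p─⊥≡p; ∪-identityʳ)
open import Data.List.Relation.Unary.All as All using (All; []; _∷_)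
open import Data.List.Relation.Unary.AllPairs using ([]; _∷_)
open import Data.Nat using (suc; _+_; _*_; _≤_; _<_; z≤n; s≤s)
open import Data.Nat.Divisibility using (divides; ∣m∣n⇒∣m+n; ∣m+n∣m⇒∣n; n∣m*n)
open import Data.Nat.Induction using (<-wellFounded)
open import Data.Nat.Properties
  using (≤-reflexive; ≤-trans; +-mono-≤; +-monoʳ-≤; m≤n+m; m≤n⇒m≤1+n; m<n+m; <⇒≱; <⇒≢;
         +-comm; +-identityʳ; +-suc; *-distribˡ-+; m∸n+n≡m; suc-injective; +-commutativeSemigroup)
open import Algebra.Properties.CommutativeSemigroup +-commutativeSemigroup using (interchange)
open import Data.Nat.Tactic.RingSolver using (solve-∀)
open import Data.Product using (Σ; ∃; _,_; proj₁; proj₂)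
open import Data.Sum using (_⊎_; inj₁; inj₂)
import Data.Sum as Sum
open import Data.Vec using (Vec; []; _∷_; lookup; _[_]≔_)
open import Data.Vec.Properties
  using (≡-dec; lookup-map; lookup-zipWith; lookup-replicate; lookup∘update; lookup∘update′;
         []=⇒lookup; lookup⇒[]=; tabulate∘lookup; tabulate-cong)
open import Function using (_∘_; _$_)
open import Function.Bundles using (Equivalence)
open import Induction.WellFounded using (Acc; acc)
open import Relation.Binary.PropositionalEquality
open import Relation.Nullary using (yes; no; contradiction)

open ≡-Reasoning

toℕ : Bool → ℕ
toℕ false = 0
toℕ true  = 1

≡-lookup : ∀ {A : Set} {n} {u v : Vec A n} → (∀ k → lookup u k ≡ lookup v k) → u ≡ v
≡-lookup {u = u} {v} eq =
  trans (sym (tabulate∘lookup u)) (trans (tabulate-cong eq) (tabulate∘lookup v))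

module _ {n : ℕ} where

  by-coordinate : {P : Fin n → Set} (i : Fin n) →
                  P i → (∀ k → k ≢ i → P k) → ∀ k → P k
  by-coordinate i pᵢ p k with k ≟ i
  ... | yes refl = pᵢ
  ... | no k≢i   = p k k≢i

  by-coordinates : {P : Fin n → Set} (i j : Fin n) →
                   P i → (j ≢ i → P j) → (∀ k → k ≢ i → k ≢ j → P k) → ∀ k → P k
  by-coordinates i j pᵢ pⱼ p k with k ≟ i | k ≟ j
  ... | yes refl | _        = pᵢ
  ... | no k≢i   | yes refl = pⱼ k≢i
  ... | no k≢i   | no k≢j   = p k k≢i k≢j

∣∷∣ : ∀ {n} x (p : Subset n) → ∣ x ∷ p ∣ ≡ toℕ x + ∣ p ∣
∣∷∣ false p = refl
∣∷∣ true  p = refl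

∣p∣≡0 : ∀ {n} (p : Subset n) → (∀ k → lookup p k ≡ false) → ∣ p ∣ ≡ 0
∣p∣≡0 {n} p all-false =
  trans (cong ∣_∣ (≡-lookup {u = p} {v = ⊥} λ k →
                     trans (all-false k) (sym (lookup-replicate k false))))
        (∣⊥∣≡0 n)

∣p∣-one-point : ∀ {n} (p : Subset n) i → (∀ k → k ≢ i → lookup p k ≡ false) →
                ∣ p ∣ ≡ toℕ (lookup p i)
∣p∣-one-point (x ∷ p) zero    false-elsewhere =
  trans (∣∷∣ x p) (trans (cong (toℕ x +_) (∣p∣≡0 p λ k → false-elsewhere (suc k) λ ()))
                         (+-identityʳ _))
∣p∣-one-point (x ∷ p) (suc i) false-elsewhere =
  trans (∣∷∣ x p) (cong₂ _+_ (cong toℕ (false-elsewhere zero λ ()))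
                             (∣p∣-one-point p i λ k k≢i →
                                false-elsewhere (suc k) (k≢i ∘ suc-injectiveᶠ)))

lookup-─ : ∀ {n} (p q : Subset n) k → lookup (p ─ q) k ≡ lookup p k ∧ not (lookup q k)
lookup-─ (x ∷ p) (true  ∷ q) zero    = sym (∧-zeroʳ x)
lookup-─ (x ∷ p) (false ∷ q) zero    = sym (∧-identityʳ x)
lookup-─ (x ∷ p) (y     ∷ q) (suc k) = lookup-─ p q k

∪⁅⁆≡[]≔ : ∀ {n} (p : Subset n) i → p ∪ ⁅ i ⁆ ≡ p [ i ]≔ true
∪⁅⁆≡[]≔ (x ∷ p) zero    = cong₂ _∷_ (∨-zeroʳ x) (∪-identityʳ p)
∪⁅⁆≡[]≔ (x ∷ p) (suc i) = cong₂ _∷_ (∨-identityʳ x) (∪⁅⁆≡[]≔ p i)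

-≡[]≔ : ∀ {n} (p : Subset n) i → p - i ≡ p [ i ]≔ false
-≡[]≔ (x ∷ p) zero    = cong (false ∷_) (p─⊥≡p p)
-≡[]≔ (x ∷ p) (suc i) = cong (x ∷_) (-≡[]≔ p i)

∣p∣+∣q∣≤n : ∀ {n} (p q : Subset n) → ∣ p ∩ q ∣ ≡ 0 → ∣ p ∣ + ∣ q ∣ ≤ n
∣p∣+∣q∣≤n []          []          _ = z≤n
∣p∣+∣q∣≤n (true  ∷ p) (true  ∷ q) ()
∣p∣+∣q∣≤n (true  ∷ p) (false ∷ q) d = s≤s (∣p∣+∣q∣≤n p q d)
∣p∣+∣q∣≤n {suc n} (false ∷ p) (true ∷ q) d =
  subst (_≤ suc n) (sym (+-suc _ _)) (s≤s (∣p∣+∣q∣≤n p q d))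
∣p∣+∣q∣≤n (false ∷ p) (false ∷ q) d = m≤n⇒m≤1+n (∣p∣+∣q∣≤n p q d)

∣p∣+∣q∣≡n⇒p≡∁q : ∀ {n} (p q : Subset n) →
                 ∣ p ∣ + ∣ q ∣ ≡ n → ∣ p ∩ q ∣ ≡ 0 → p ≡ ∁ q
∣p∣+∣q∣≡n⇒p≡∁q []          []          _ _ = refl
∣p∣+∣q∣≡n⇒p≡∁q (true  ∷ p) (true  ∷ q) _ ()
∣p∣+∣q∣≡n⇒p≡∁q (true  ∷ p) (false ∷ q) e d =
  cong (true ∷_) (∣p∣+∣q∣≡n⇒p≡∁q p q (suc-injective e) d)
∣p∣+∣q∣≡n⇒p≡∁q (false ∷ p) (true  ∷ q) e d =
  cong (false ∷_) (∣p∣+∣q∣≡n⇒p≡∁q p q (suc-injective (trans (sym (+-suc _ _)) e)) d)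
∣p∣+∣q∣≡n⇒p≡∁q (false ∷ p) (false ∷ q) e d =
  contradiction e (<⇒≢ (s≤s (∣p∣+∣q∣≤n p q d)))

∣─∣-triangle : ∀ {n} (p q r : Subset n) → ∣ p ─ r ∣ ≤ ∣ p ─ q ∣ + ∣ q ─ r ∣
∣─∣-triangle []          []          []          = z≤n
∣─∣-triangle (true  ∷ p) (true  ∷ q) (true  ∷ r) = ∣─∣-triangle p q r
∣─∣-triangle (true  ∷ p) (true  ∷ q) (false ∷ r) =
  ≤-trans (s≤s (∣─∣-triangle p q r)) (≤-reflexive (sym (+-suc _ _)))
∣─∣-triangle (true  ∷ p) (false ∷ q) (true  ∷ r) = m≤n⇒m≤1+n (∣─∣-triangle p q r)
∣─∣-triangle (true  ∷ p) (false ∷ q) (false ∷ r) = s≤s (∣─∣-triangle p q r)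
∣─∣-triangle (false ∷ p) (true  ∷ q) (true  ∷ r) = ∣─∣-triangle p q r
∣─∣-triangle (false ∷ p) (true  ∷ q) (false ∷ r) =
  ≤-trans (m≤n⇒m≤1+n (∣─∣-triangle p q r)) (≤-reflexive (sym (+-suc _ _)))
∣─∣-triangle (false ∷ p) (false ∷ q) (true  ∷ r) = ∣─∣-triangle p q r
∣─∣-triangle (false ∷ p) (false ∷ q) (false ∷ r) = ∣─∣-triangle p q r

-- The cell of a subset of E at k records whether k and k* belong to it;
-- `only b` is the cell holding just the element (k , b).
Cell : Set
Cell = Bool × Bool

empty full : Cell
empty = false , false
full  = true  , true

only : Bool → Cell
only b = not b , b

has : Bool → Cell → Bool
has false = proj₁
has true  = proj₂

set : Bool → Bool → Cell → Cell
set false v (x , y) = v , y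
set true  v (x , y) = x , v

both : Cell → Bool
both (x , y) = x ∧ y

count : Cell → ℕ
count (x , y) = toℕ x + toℕ y

_─ᶜ_ : Cell → Cell → Cell
(x , y) ─ᶜ (x' , y') = x ∧ not x' , y ∧ not y'

has-only : ∀ b → has b (only b) ≡ true
has-only false = refl
has-only true  = refl

has-only⁻ : ∀ {b c} → has b (only c) ≡ true → c ≡ b
has-only⁻ {false} {false} _ = refl
has-only⁻ {true}  {true}  _ = refl

has-full : ∀ b → has b full ≡ true
has-full false = refl
has-full true  = refl

has-empty : ∀ b → has b empty ≡ false
has-empty false = refl
has-empty true  = refl

both-only : ∀ b → both (only b) ≡ false
both-only false = refl
both-only true  = refl

both-set-false : ∀ b c → both (set b false c) ≡ false
both-set-false false c = refl
both-set-false true  c = ∧-zeroʳ _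

set-false-only : ∀ b → set b false (only b) ≡ empty
set-false-only false = refl
set-false-only true  = refl

set-true-empty : ∀ b → set b true empty ≡ only b
set-true-empty false = refl
set-true-empty true  = refl

set-true-only : ∀ {b c} → c ≢ b → set b true (only c) ≡ full
set-true-only {false} {false} c≢b = contradiction refl c≢b
set-true-only {false} {true}  _   = refl
set-true-only {true}  {false} _   = refl
set-true-only {true}  {true}  c≢b = contradiction refl c≢b

set-false-full : ∀ {b c} → b ≢ c → set b false full ≡ only c
set-false-full {false} {false} b≢c = contradiction refl b≢c
set-false-full {false} {true}  _   = refl
set-false-full {true}  {false} _   = refl
set-false-full {true}  {true}  b≢c = contradiction refl b≢c

─ᶜ-empty : ∀ c → c ─ᶜ empty ≡ c
─ᶜ-empty (x , y) = cong₂ _,_ (∧-identityʳ x) (∧-identityʳ y)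

─ᶜ-full : ∀ c → c ─ᶜ full ≡ empty
─ᶜ-full (x , y) = cong₂ _,_ (∧-zeroʳ x) (∧-zeroʳ y)

─ᶜ-self : ∀ c → c ─ᶜ c ≡ empty
─ᶜ-self (x , y) = cong₂ _,_ (∧-inverseʳ x) (∧-inverseʳ y)

count-only : ∀ b → count (only b) ≡ 1
count-only false = refl
count-only true  = refl

module _ {n : ℕ} where

  at : Sub n → Fin n → Cell
  at (P , Q) k = lookup P k , lookup Q k

  ≡-at : ∀ {S T : Sub n} → (∀ k → at S k ≡ at T k) → S ≡ T
  ≡-at {P , Q} {P' , Q'} eq =
    cong₂ _,_ (≡-lookup (cong proj₁ ∘ eq)) (≡-lookup (cong proj₂ ∘ eq))

  ∈E⇒has : ∀ {S k b} → (k , b) ∈E S → has b (at S k) ≡ true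
  ∈E⇒has {P , Q} {b = false} = []=⇒lookup
  ∈E⇒has {P , Q} {b = true}  = []=⇒lookup

  has⇒∈E : ∀ {S k b} → has b (at S k) ≡ true → (k , b) ∈E S
  has⇒∈E {P , Q} {k} {false} = lookup⇒[]= k P
  has⇒∈E {P , Q} {k} {true}  = lookup⇒[]= k Q

  at-∖ : ∀ (S T : Sub n) k → at (S ∖ T) k ≡ at S k ─ᶜ at T k
  at-∖ (P , Q) (P' , Q') k = cong₂ _,_ (lookup-─ P P' k) (lookup-─ Q Q' k)

  at-addE : ∀ (S : Sub n) i b → at (addE (i , b) S) i ≡ set b true (at S i)
  at-addE (P , Q) i false rewrite ∪⁅⁆≡[]≔ P i = cong (_, lookup Q i) (lookup∘update i P true)
  at-addE (P , Q) i true  rewrite ∪⁅⁆≡[]≔ Q i = cong (lookup P i ,_) (lookup∘update i Q true)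

  at-addE-≢ : ∀ (S : Sub n) i b {k} → k ≢ i → at (addE (i , b) S) k ≡ at S k
  at-addE-≢ (P , Q) i false {k} k≢i rewrite ∪⁅⁆≡[]≔ P i =
    cong (_, lookup Q k) (lookup∘update′ k≢i P true)
  at-addE-≢ (P , Q) i true  {k} k≢i rewrite ∪⁅⁆≡[]≔ Q i =
    cong (lookup P k ,_) (lookup∘update′ k≢i Q true)

  at-delE : ∀ (S : Sub n) i b → at (delE (i , b) S) i ≡ set b false (at S i)
  at-delE (P , Q) i false rewrite -≡[]≔ P i = cong (_, lookup Q i) (lookup∘update i P false)
  at-delE (P , Q) i true  rewrite -≡[]≔ Q i = cong (lookup P i ,_) (lookup∘update i Q false)

  at-delE-≢ : ∀ (S : Sub n) i b {k} → k ≢ i → at (delE (i , b) S) k ≡ at S k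
  at-delE-≢ (P , Q) i false {k} k≢i rewrite -≡[]≔ P i =
    cong (_, lookup Q k) (lookup∘update′ k≢i P false)
  at-delE-≢ (P , Q) i true  {k} k≢i rewrite -≡[]≔ Q i =
    cong (lookup P k ,_) (lookup∘update′ k≢i Q false)

  at-addPair : ∀ (S : Sub n) i → at (addPair i S) i ≡ full
  at-addPair (P , Q) i rewrite ∪⁅⁆≡[]≔ P i | ∪⁅⁆≡[]≔ Q i =
    cong₂ _,_ (lookup∘update i P true) (lookup∘update i Q true)

  at-addPair-≢ : ∀ (S : Sub n) i {k} → k ≢ i → at (addPair i S) k ≡ at S k
  at-addPair-≢ (P , Q) i {k} k≢i rewrite ∪⁅⁆≡[]≔ P i | ∪⁅⁆≡[]≔ Q i =
    cong₂ _,_ (lookup∘update′ k≢i P true) (lookup∘update′ k≢i Q true)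

  at-delPair : ∀ (S : Sub n) i → at (delPair i S) i ≡ empty
  at-delPair (P , Q) i rewrite -≡[]≔ P i | -≡[]≔ Q i =
    cong₂ _,_ (lookup∘update i P false) (lookup∘update i Q false)

  at-delPair-≢ : ∀ (S : Sub n) i {k} → k ≢ i → at (delPair i S) k ≡ at S k
  at-delPair-≢ (P , Q) i {k} k≢i rewrite -≡[]≔ P i | -≡[]≔ Q i =
    cong₂ _,_ (lookup∘update′ k≢i P false) (lookup∘update′ k≢i Q false)

  size≡0 : ∀ {S : Sub n} → (∀ k → at S k ≡ empty) → size S ≡ 0
  size≡0 {P , Q} h = cong₂ _+_ (∣p∣≡0 P (cong proj₁ ∘ h)) (∣p∣≡0 Q (cong proj₂ ∘ h))

  size-one-cell : ∀ {S : Sub n} i → (∀ k → k ≢ i → at S k ≡ empty) → size S ≡ count (at S i)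
  size-one-cell {P , Q} i h =
    cong₂ _+_ (∣p∣-one-point P i λ k k≢i → cong proj₁ (h k k≢i))
              (∣p∣-one-point Q i λ k k≢i → cong proj₂ (h k k≢i))

  skews≡0 : ∀ {S : Sub n} → (∀ k → both (at S k) ≡ false) → skews S ≡ 0
  skews≡0 {P , Q} h = ∣p∣≡0 (P ∩ Q) λ k → trans (lookup-zipWith _∧_ k P Q) (h k)

  skews≡1 : ∀ {S : Sub n} i → both (at S i) ≡ true →
            (∀ k → k ≢ i → both (at S k) ≡ false) → skews S ≡ 1
  skews≡1 {P , Q} i hᵢ h =
    trans (∣p∣-one-point (P ∩ Q) i λ k k≢i → trans (lookup-zipWith _∧_ k P Q) (h k k≢i))
          (cong toℕ (trans (lookup-zipWith _∧_ i P Q) hᵢ))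

  size-∖-self : ∀ (S : Sub n) → size (S ∖ S) ≡ 0
  size-∖-self S = size≡0 {S ∖ S} λ k → trans (at-∖ S S k) (─ᶜ-self (at S k))

  size-∖-triangle : ∀ (S T U : Sub n) → size (S ∖ U) ≤ size (S ∖ T) + size (T ∖ U)
  size-∖-triangle (P , Q) (P' , Q') (P'' , Q'') = ≤-trans
    (+-mono-≤ (∣─∣-triangle P P' P'') (∣─∣-triangle Q Q' Q''))
    (≤-reflexive (interchange (∣ P ─ P' ∣) (∣ P' ─ P'' ∣) (∣ Q ─ Q' ∣) (∣ Q' ─ Q'' ∣)))

-- Hamming distance

xor-≢ : ∀ {a b} → a ≢ b → toℕ (a xor b) ≡ 1
xor-≢ {false} {false} a≢b = contradiction refl a≢b
xor-≢ {false} {true}  _   = refl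
xor-≢ {true}  {false} _   = refl
xor-≢ {true}  {true}  a≢b = contradiction refl a≢b

toℕ+1≡1⊎2 : ∀ x → toℕ x + 1 ≡ 1 ⊎ toℕ x + 1 ≡ 2
toℕ+1≡1⊎2 false = inj₁ refl
toℕ+1≡1⊎2 true  = inj₂ refl

xor-between : ∀ {a b c} → b ≡ a ⊎ b ≡ c → toℕ (a xor b) + toℕ (b xor c) ≡ toℕ (a xor c)
xor-between {a} {c = c} (inj₁ refl) = cong (λ x → toℕ x + toℕ (a xor c)) (xor-same a)
xor-between {a} {b}     (inj₂ refl) =
  trans (cong (λ x → toℕ (a xor b) + toℕ x) (xor-same b)) (+-identityʳ _)

xor-parity : ∀ a b → toℕ (a xor b) + 2 * toℕ (a ∧ b) ≡ toℕ a + toℕ b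
xor-parity false false = refl
xor-parity false true  = refl
xor-parity true  false = refl
xor-parity true  true  = refl

bool-dichotomy : ∀ {a b : Bool} → a ≢ b → ∀ x → x ≡ a ⊎ x ≡ b
bool-dichotomy {a} a≢b x with x Bool.≟ a
... | yes x≡a = inj₁ x≡a
... | no  x≢a = inj₂ (trans (¬-not x≢a) (sym (¬-not (≢-sym a≢b))))

hamming : ∀ {n} → Subset n → Subset n → ℕ
hamming []      []      = 0
hamming (a ∷ s) (b ∷ t) = toℕ (a xor b) + hamming s t

hamming-self : ∀ {n} (s : Subset n) → hamming s s ≡ 0
hamming-self []      = refl
hamming-self (a ∷ s) = cong₂ _+_ (cong toℕ (xor-same a)) (hamming-self s)

hamming-[]≔ : ∀ {n} (s : Subset n) i x → hamming s (s [ i ]≔ x) ≡ toℕ (lookup s i xor x)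
hamming-[]≔ (a ∷ s) zero    x = trans (cong (toℕ (a xor x) +_) (hamming-self s)) (+-identityʳ _)
hamming-[]≔ (a ∷ s) (suc i) x = cong₂ _+_ (cong toℕ (xor-same a)) (hamming-[]≔ s i x)

record Between {n} (s q t : Subset n) : Set where
  constructor between
  field coordinatewise : ∀ k → lookup q k ≡ lookup s k ⊎ lookup q k ≡ lookup t k

hamming-between : ∀ {n} (s q t : Subset n) → Between s q t →
                  hamming s q + hamming q t ≡ hamming s t
hamming-between []      []      []      _ = refl
hamming-between (a ∷ s) (b ∷ q) (c ∷ t) (between q-between) = begin
  (toℕ (a xor b) + hamming s q) + (toℕ (b xor c) + hamming q t)
    ≡⟨ interchange (toℕ (a xor b)) _ (toℕ (b xor c)) _ ⟩
  (toℕ (a xor b) + toℕ (b xor c)) + (hamming s q + hamming q t)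
    ≡⟨ cong₂ _+_ (xor-between (q-between zero)) (hamming-between s q t (between (q-between ∘ suc))) ⟩
  toℕ (a xor c) + hamming s t ∎

between-refl : ∀ {n} {s t : Subset n} → Between s s t
between-refl = between λ _ → inj₁ refl

between-[]≔ : ∀ {n} {s q t : Subset n} {k x} → x ≡ lookup s k ⊎ x ≡ lookup t k →
              Between s q t → Between s (q [ k ]≔ x) t
between-[]≔ {s = s} {q} {t} {k} {x} x-between (between q-between) = between $
  by-coordinate k (subst (Side k) (sym (lookup∘update k q x)) x-between)
                  λ k' k'≢k → subst (Side k') (sym (lookup∘update′ k'≢k q x)) (q-between k')
  where
  Side : Fin _ → Bool → Set
  Side k z = z ≡ lookup s k ⊎ z ≡ lookup t k

hamming-[]≔-[]≔ : ∀ {n} (s : Subset n) {i j} x y → j ≢ i →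
                  hamming s (s [ i ]≔ x [ j ]≔ y) ≡ toℕ (lookup s i xor x) + toℕ (lookup s j xor y)
hamming-[]≔-[]≔ s {i} {j} x y j≢i = begin
  hamming s (s [ i ]≔ x [ j ]≔ y)
    ≡⟨ sym (hamming-between s (s [ i ]≔ x) (s [ i ]≔ x [ j ]≔ y) middle) ⟩
  hamming s (s [ i ]≔ x) + hamming (s [ i ]≔ x) (s [ i ]≔ x [ j ]≔ y)
    ≡⟨ cong₂ _+_ (hamming-[]≔ s i x) (hamming-[]≔ (s [ i ]≔ x) j y) ⟩
  toℕ (lookup s i xor x) + toℕ (lookup (s [ i ]≔ x) j xor y)
    ≡⟨ cong (λ z → toℕ (lookup s i xor x) + toℕ (z xor y)) (lookup∘update′ j≢i s x) ⟩
  toℕ (lookup s i xor x) + toℕ (lookup s j xor y) ∎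
  where
  middle : Between s (s [ i ]≔ x) (s [ i ]≔ x [ j ]≔ y)
  middle = between $ by-coordinate j (inj₁ (lookup∘update′ j≢i s x))
                           λ k k≢j → inj₂ (sym (lookup∘update′ k≢j (s [ i ]≔ x) y))

hamming-parity : ∀ {n} (s t : Subset n) → hamming s t + 2 * ∣ s ∩ t ∣ ≡ ∣ s ∣ + ∣ t ∣
hamming-parity []      []      = refl
hamming-parity (a ∷ s) (b ∷ t) = begin
  toℕ (a xor b) + hamming s t + 2 * ∣ (a ∧ b) ∷ (s ∩ t) ∣
    ≡⟨ cong (λ m → toℕ (a xor b) + hamming s t + 2 * m) (∣∷∣ (a ∧ b) (s ∩ t)) ⟩
  toℕ (a xor b) + hamming s t + 2 * (toℕ (a ∧ b) + ∣ s ∩ t ∣)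
    ≡⟨ cong (toℕ (a xor b) + hamming s t +_) (*-distribˡ-+ 2 (toℕ (a ∧ b)) ∣ s ∩ t ∣) ⟩
  toℕ (a xor b) + hamming s t + (2 * toℕ (a ∧ b) + 2 * ∣ s ∩ t ∣)
    ≡⟨ interchange (toℕ (a xor b)) (hamming s t) (2 * toℕ (a ∧ b)) _ ⟩
  (toℕ (a xor b) + 2 * toℕ (a ∧ b)) + (hamming s t + 2 * ∣ s ∩ t ∣)
    ≡⟨ cong₂ _+_ (xor-parity a b) (hamming-parity s t) ⟩
  (toℕ a + toℕ b) + (∣ s ∣ + ∣ t ∣)
    ≡⟨ interchange (toℕ a) (toℕ b) ∣ s ∣ ∣ t ∣ ⟩
  (toℕ a + ∣ s ∣) + (toℕ b + ∣ t ∣)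
    ≡⟨ sym (cong₂ _+_ (∣∷∣ a s) (∣∷∣ b t)) ⟩
  ∣ a ∷ s ∣ + ∣ b ∷ t ∣ ∎

2∣m+m : ∀ m → 2 ∣ m + m
2∣m+m m = divides m (double m)
  where
  double : ∀ m → m + m ≡ m * 2
  double = solve-∀

2∣-chain : ∀ x y a b c → 2 ∣ x + (a + b) → 2 ∣ y + (b + c) → 2 ∣ (x + y) + (a + c)
2∣-chain x y a b c ∣x+a+b ∣y+b+c =
  ∣m+n∣m⇒∣n (subst (2 ∣_) (regroup x y a b c) (∣m∣n⇒∣m+n ∣x+a+b ∣y+b+c)) (n∣m*n b)
  where
  regroup : ∀ x y a b c → (x + (a + b)) + (y + (b + c)) ≡ b * 2 + ((x + y) + (a + c))
  regroup = solve-∀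

hamming-even : ∀ {n} (s t : Subset n) → 2 ∣ hamming s t + (∣ s ∣ + ∣ t ∣)
hamming-even s t = subst (λ m → 2 ∣ hamming s t + m) (hamming-parity s t)
  (divides (hamming s t + ∣ s ∩ t ∣) (double (hamming s t) ∣ s ∩ t ∣))
  where
  double : ∀ h x → h + (h + 2 * x) ≡ (h + x) * 2
  double = solve-∀

-- Transversals

module _ {n : ℕ} where

  tr : Subset n → Sub n
  tr s = ∁ s , s

  at-tr : ∀ s k → at (tr s) k ≡ only (lookup s k)
  at-tr s k = cong (_, lookup s k) (lookup-map k not s)

  tr-transversal : ∀ s → IsTransversal n (tr s)
  tr-transversal s =
    trans (cong (_+ ∣ s ∣) (∣∁p∣≡n∸∣p∣ s)) (m∸n+n≡m (∣p∣≤n s)) ,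
    skews≡0 {S = tr s} λ k → trans (cong both (at-tr s k)) (both-only (lookup s k))

  ∈-tr : ∀ s k → (k , lookup s k) ∈E tr s
  ∈-tr s k = has⇒∈E {S = tr s} (trans (cong (has (lookup s k)) (at-tr s k)) (has-only (lookup s k)))

  ∈-tr⁻ : ∀ s {k b} → (k , b) ∈E tr s → lookup s k ≡ b
  ∈-tr⁻ s {k} {b} k,b∈ =
    has-only⁻ (trans (cong (has b) (sym (at-tr s k))) (∈E⇒has {S = tr s} k,b∈))

  ∉-tr : ∀ s {k b} → lookup s k ≢ b → (k , b) ∉E tr s
  ∉-tr s sₖ≢b k,b∈ = sₖ≢b (∈-tr⁻ s k,b∈)

  ∉-tr⁻ : ∀ s {k b} → (k , b) ∉E tr s → lookup s k ≢ b
  ∉-tr⁻ s {k} k,b∉ refl = k,b∉ (∈-tr s k)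

transversal-tr : ∀ {n} {S : Sub n} → IsTransversal n S → ∃ λ s → S ≡ tr s
transversal-tr {S = P , Q} (size≡n , skews≡0) =
  Q , cong (_, Q) (∣p∣+∣q∣≡n⇒p≡∁q P Q size≡n skews≡0)

size-tr-∖-tr : ∀ {n} (s t : Subset n) → size (tr s ∖ tr t) ≡ hamming s t
size-tr-∖-tr []          []          = refl
size-tr-∖-tr (true  ∷ s) (true  ∷ t) = size-tr-∖-tr s t
size-tr-∖-tr (true  ∷ s) (false ∷ t) = trans (+-suc _ _) (cong suc (size-tr-∖-tr s t))
size-tr-∖-tr (false ∷ s) (true  ∷ t) = cong suc (size-tr-∖-tr s t)
size-tr-∖-tr (false ∷ s) (false ∷ t) = size-tr-∖-tr s t

-- Exchanges inside a transversal

module _ {n : ℕ} where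

  pairSwap : Fin n → Fin n → Sub n → Sub n
  pairSwap i j S = delPair i (addPair j S)

  at-pairSwap-i : ∀ (S : Sub n) i j → at (pairSwap i j S) i ≡ empty
  at-pairSwap-i S i j = at-delPair (addPair j S) i

  at-pairSwap-j : ∀ (S : Sub n) {i j} → j ≢ i → at (pairSwap i j S) j ≡ full
  at-pairSwap-j S {i} {j} j≢i = trans (at-delPair-≢ (addPair j S) i j≢i) (at-addPair S j)

  at-pairSwap-≢ : ∀ (S : Sub n) {i j k} → k ≢ i → k ≢ j → at (pairSwap i j S) k ≡ at S k
  at-pairSwap-≢ S {i} {j} k≢i k≢j =
    trans (at-delPair-≢ (addPair j S) i k≢i) (at-addPair-≢ S j k≢j)

  has-false⇒∉E : ∀ {S : Sub n} {k b} → has b (at S k) ≡ false → (k , b) ∉E S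
  has-false⇒∉E {S} ¬has k,b∈ with trans (sym (∈E⇒has {S = S} k,b∈)) ¬has
  ... | ()

  ∈E-pairSwap : ∀ (S : Sub n) {i j} b → j ≢ i → (j , b) ∈E pairSwap i j S
  ∈E-pairSwap S b j≢i =
    has⇒∈E {S = pairSwap _ _ S} (trans (cong (has b) (at-pairSwap-j S j≢i)) (has-full b))

  ∉E-pairSwap : ∀ (S : Sub n) i j b → (i , b) ∉E pairSwap i j S
  ∉E-pairSwap S i j b =
    has-false⇒∉E {S = pairSwap i j S} (trans (cong (has b) (at-pairSwap-i S i j)) (has-empty b))

  -- The two pairSwaps agree outside i and j, and pairSwap j i S has nothing at j.
  pairSwap-difference : ∀ (S : Sub n) {i j k d} →
    (k , d) ∈E pairSwap j i S → (k , d) ∉E pairSwap i j S → k ≡ i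
  pairSwap-difference S {i} {j} {k} {d} k,d∈ k,d∉ with k ≟ i | k ≟ j
  ... | yes k≡i | _        = k≡i
  ... | no _    | yes refl = contradiction k,d∈ (∉E-pairSwap S k i d)
  ... | no k≢i  | no k≢j   = contradiction (has⇒∈E {S = pairSwap i j S} same-cell) k,d∉
    where
    same-cell : has d (at (pairSwap i j S) k) ≡ true
    same-cell =
      trans (cong (has d) (trans (at-pairSwap-≢ S k≢i k≢j) (sym (at-pairSwap-≢ S k≢j k≢i))))
            (∈E⇒has {S = pairSwap j i S} k,d∈)

module _ {n : ℕ} (s : Subset n) where

  both-at-tr : ∀ (S : Sub n) {k} → at S k ≡ at (tr s) k → both (at S k) ≡ false
  both-at-tr S {k} eq = trans (cong both (trans eq (at-tr s k))) (both-only (lookup s k))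

  skews-delE-tr : ∀ e → skews (delE e (tr s)) ≡ 0
  skews-delE-tr (i , b) = skews≡0 {S = delE (i , b) (tr s)} (by-coordinate i
    (trans (cong both (at-delE (tr s) i b)) (both-set-false b _))
    λ k k≢i → both-at-tr (delE (i , b) (tr s)) (at-delE-≢ (tr s) i b k≢i))

  skews-addE-tr : ∀ {i b} → lookup s i ≢ b → skews (addE (i , b) (tr s)) ≡ 1
  skews-addE-tr {i} {b} sᵢ≢b = skews≡1 {S = addE (i , b) (tr s)} i
    (cong both (trans (at-addE (tr s) i b) (trans (cong (set b true) (at-tr s i)) (set-true-only sᵢ≢b))))
    λ k k≢i → both-at-tr (addE (i , b) (tr s)) (at-addE-≢ (tr s) i b k≢i)

  exchange-within-pair : ∀ i b → addE (i , b) (delE (i , lookup s i) (tr s)) ≡ tr (s [ i ]≔ b)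
  exchange-within-pair i b = ≡-at (by-coordinate i at-i other)
    where
    X = delE (i , lookup s i) (tr s)
    at-i : at (addE (i , b) X) i ≡ at (tr (s [ i ]≔ b)) i
    at-i = begin
      at (addE (i , b) X) i                      ≡⟨ at-addE X i b ⟩
      set b true (at X i)                        ≡⟨ cong (set b true) (at-delE (tr s) i (lookup s i)) ⟩
      set b true (set (lookup s i) false (at (tr s) i))
        ≡⟨ cong (λ c → set b true (set (lookup s i) false c)) (at-tr s i) ⟩
      set b true (set (lookup s i) false (only (lookup s i)))
        ≡⟨ cong (set b true) (set-false-only (lookup s i)) ⟩
      set b true empty                           ≡⟨ set-true-empty b ⟩
      only b                                     ≡⟨ cong only (sym (lookup∘update i s b)) ⟩
      only (lookup (s [ i ]≔ b) i)               ≡⟨ sym (at-tr (s [ i ]≔ b) i) ⟩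
      at (tr (s [ i ]≔ b)) i                     ∎
    other : ∀ k → k ≢ i → at (addE (i , b) X) k ≡ at (tr (s [ i ]≔ b)) k
    other k k≢i = begin
      at (addE (i , b) X) k        ≡⟨ at-addE-≢ X i b k≢i ⟩
      at X k                       ≡⟨ at-delE-≢ (tr s) i (lookup s i) k≢i ⟩
      at (tr s) k                  ≡⟨ at-tr s k ⟩
      only (lookup s k)            ≡⟨ cong only (sym (lookup∘update′ k≢i s b)) ⟩
      only (lookup (s [ i ]≔ b) k) ≡⟨ sym (at-tr (s [ i ]≔ b) k) ⟩
      at (tr (s [ i ]≔ b)) k       ∎

  skews-delE-pairSwap : ∀ i j b → skews (delE (j , b) (pairSwap i j (tr s))) ≡ 0
  skews-delE-pairSwap i j b = skews≡0 {S = delE (j , b) A} (by-coordinates j i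
    (trans (cong both (at-delE A j b)) (both-set-false b (at A j)))
    (λ i≢j → cong both (trans (at-delE-≢ A j b i≢j) (at-pairSwap-i (tr s) i j)))
    λ k k≢j k≢i → both-at-tr (delE (j , b) A)
                    (trans (at-delE-≢ A j b k≢j) (at-pairSwap-≢ (tr s) k≢i k≢j)))
    where A = pairSwap i j (tr s)

module _ {n : ℕ} (s : Subset n) {i j : Fin n} (j≢i : j ≢ i) where
  private
    i≢j : i ≢ j
    i≢j = ≢-sym j≢i
    A A' : Sub n
    A  = pairSwap i j (tr s)
    A' = pairSwap j i (tr s)

  exchange-across-pairs : ∀ {b} → lookup s j ≢ b →
    addE (j , b) (delE (i , lookup s i) (tr s)) ≡ pairSwap i j (tr s)
  exchange-across-pairs {b} sⱼ≢b = ≡-at (by-coordinates i j at-i (λ _ → at-j) other)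
    where
    X = delE (i , lookup s i) (tr s)
    at-i : at (addE (j , b) X) i ≡ at A i
    at-i = begin
      at (addE (j , b) X) i                      ≡⟨ at-addE-≢ X j b i≢j ⟩
      at X i                                     ≡⟨ at-delE (tr s) i (lookup s i) ⟩
      set (lookup s i) false (at (tr s) i)       ≡⟨ cong (set (lookup s i) false) (at-tr s i) ⟩
      set (lookup s i) false (only (lookup s i)) ≡⟨ set-false-only (lookup s i) ⟩
      empty                                      ≡⟨ sym (at-pairSwap-i (tr s) i j) ⟩
      at A i                                     ∎
    at-j : at (addE (j , b) X) j ≡ at A j
    at-j = begin
      at (addE (j , b) X) j          ≡⟨ at-addE X j b ⟩
      set b true (at X j)            ≡⟨ cong (set b true) (at-delE-≢ (tr s) i (lookup s i) j≢i) ⟩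
      set b true (at (tr s) j)       ≡⟨ cong (set b true) (at-tr s j) ⟩
      set b true (only (lookup s j)) ≡⟨ set-true-only sⱼ≢b ⟩
      full                           ≡⟨ sym (at-pairSwap-j (tr s) j≢i) ⟩
      at A j                         ∎
    other : ∀ k → k ≢ i → k ≢ j → at (addE (j , b) X) k ≡ at A k
    other k k≢i k≢j = begin
      at (addE (j , b) X) k ≡⟨ at-addE-≢ X j b k≢j ⟩
      at X k                ≡⟨ at-delE-≢ (tr s) i (lookup s i) k≢i ⟩
      at (tr s) k           ≡⟨ sym (at-pairSwap-≢ (tr s) k≢i k≢j) ⟩
      at A k                ∎

  skews-pairSwap : skews (pairSwap i j (tr s)) ≡ 1
  skews-pairSwap = skews≡1 {S = A} j (cong both (at-pairSwap-j (tr s) j≢i))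
    (by-coordinate i (λ _ → cong both (at-pairSwap-i (tr s) i j))
                     λ k k≢i k≢j → both-at-tr s A (at-pairSwap-≢ (tr s) k≢i k≢j))

  skews-addE-pairSwap : ∀ b → skews (addE (j , b) (pairSwap j i (tr s))) ≡ 1
  skews-addE-pairSwap b = skews≡1 {S = addE (j , b) A'} i
    (cong both (trans (at-addE-≢ A' j b i≢j) (at-pairSwap-j (tr s) i≢j)))
    (by-coordinate j (λ _ → trans (cong both at-j) (both-only b))
                     λ k k≢j k≢i → both-at-tr s (addE (j , b) A')
                                     (trans (at-addE-≢ A' j b k≢j) (at-pairSwap-≢ (tr s) k≢j k≢i)))
    where
    at-j : at (addE (j , b) A') j ≡ only b
    at-j = trans (at-addE A' j b) (trans (cong (set b true) (at-pairSwap-i (tr s) j i)) (set-true-empty b))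

  exchange-out-of-pairSwap : ∀ d {y} → lookup s j ≢ y →
    addE (i , d) (delE (j , lookup s j) (pairSwap i j (tr s))) ≡ tr (s [ i ]≔ d [ j ]≔ y)
  exchange-out-of-pairSwap d {y} sⱼ≢y = ≡-at (by-coordinates i j at-i (λ _ → at-j) other)
    where
    X = delE (j , lookup s j) A
    q = s [ i ]≔ d [ j ]≔ y
    at-i : at (addE (i , d) X) i ≡ at (tr q) i
    at-i = begin
      at (addE (i , d) X) i ≡⟨ at-addE X i d ⟩
      set d true (at X i)   ≡⟨ cong (set d true) (at-delE-≢ A j (lookup s j) i≢j) ⟩
      set d true (at A i)   ≡⟨ cong (set d true) (at-pairSwap-i (tr s) i j) ⟩
      set d true empty      ≡⟨ set-true-empty d ⟩
      only d                ≡⟨ cong only (sym (lookup∘update i s d)) ⟩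
      only (lookup (s [ i ]≔ d) i) ≡⟨ cong only (sym (lookup∘update′ i≢j (s [ i ]≔ d) y)) ⟩
      only (lookup q i)     ≡⟨ sym (at-tr q i) ⟩
      at (tr q) i           ∎
    at-j : at (addE (i , d) X) j ≡ at (tr q) j
    at-j = begin
      at (addE (i , d) X) j           ≡⟨ at-addE-≢ X i d j≢i ⟩
      at X j                          ≡⟨ at-delE A j (lookup s j) ⟩
      set (lookup s j) false (at A j) ≡⟨ cong (set (lookup s j) false) (at-pairSwap-j (tr s) j≢i) ⟩
      set (lookup s j) false full     ≡⟨ set-false-full sⱼ≢y ⟩
      only y                          ≡⟨ cong only (sym (lookup∘update j (s [ i ]≔ d) y)) ⟩
      only (lookup q j)               ≡⟨ sym (at-tr q j) ⟩
      at (tr q) j                     ∎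
    other : ∀ k → k ≢ i → k ≢ j → at (addE (i , d) X) k ≡ at (tr q) k
    other k k≢i k≢j = begin
      at (addE (i , d) X) k        ≡⟨ at-addE-≢ X i d k≢i ⟩
      at X k                       ≡⟨ at-delE-≢ A j (lookup s j) k≢j ⟩
      at A k                       ≡⟨ at-pairSwap-≢ (tr s) k≢i k≢j ⟩
      at (tr s) k                  ≡⟨ at-tr s k ⟩
      only (lookup s k)            ≡⟨ cong only (sym (lookup∘update′ k≢i s d)) ⟩
      only (lookup (s [ i ]≔ d) k) ≡⟨ cong only (sym (lookup∘update′ k≢j (s [ i ]≔ d) y)) ⟩
      only (lookup q k)            ≡⟨ sym (at-tr q k) ⟩
      at (tr q) k                  ∎

  size-tr-∖-pairSwap : ∀ t → (∀ k → k ≢ i → k ≢ j → lookup t k ≡ lookup s k) →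
                       size (tr t ∖ pairSwap i j (tr s)) ≡ 1
  size-tr-∖-pairSwap t t≈s = trans (size-one-cell {S = tr t ∖ A} i outside-i) count-at-i
    where
    outside-i : ∀ k → k ≢ i → at (tr t ∖ A) k ≡ empty
    outside-i = by-coordinate j
      (λ _ → trans (at-∖ (tr t) A j) (trans (cong (at (tr t) j ─ᶜ_) (at-pairSwap-j (tr s) j≢i))
                                             (─ᶜ-full (at (tr t) j))))
      λ k k≢j k≢i → begin
        at (tr t ∖ A) k                        ≡⟨ at-∖ (tr t) A k ⟩
        at (tr t) k ─ᶜ at A k
          ≡⟨ cong (at (tr t) k ─ᶜ_) (at-pairSwap-≢ (tr s) k≢i k≢j) ⟩
        at (tr t) k ─ᶜ at (tr s) k             ≡⟨ cong₂ _─ᶜ_ (at-tr t k) (at-tr s k) ⟩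
        only (lookup t k) ─ᶜ only (lookup s k)
          ≡⟨ cong (λ x → only x ─ᶜ only (lookup s k)) (t≈s k k≢i k≢j) ⟩
        only (lookup s k) ─ᶜ only (lookup s k) ≡⟨ ─ᶜ-self (only (lookup s k)) ⟩
        empty                                  ∎
    count-at-i : count (at (tr t ∖ A) i) ≡ 1
    count-at-i = begin
      count (at (tr t ∖ A) i)            ≡⟨ cong count (at-∖ (tr t) A i) ⟩
      count (at (tr t) i ─ᶜ at A i)
        ≡⟨ cong₂ (λ x y → count (x ─ᶜ y)) (at-tr t i) (at-pairSwap-i (tr s) i j) ⟩
      count (only (lookup t i) ─ᶜ empty) ≡⟨ cong count (─ᶜ-empty (only (lookup t i))) ⟩
      count (only (lookup t i))          ≡⟨ count-only (lookup t i) ⟩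
      1                                  ∎

-- The transversal basis graph

module _ {n : ℕ} (M : AntisymmetricMatroid n) where
  open AntisymmetricMatroid M

  weight-≥ : ∀ {B D} (w : Walk M B D) → size (B ∖ D) ≤ weight M w
  weight-≥ ([_] {B} _)           = ≤-reflexive (size-∖-self B)
  weight-≥ (_∷_ {B} {C} {D} _ w) =
    ≤-trans (size-∖-triangle B C D) (+-monoʳ-≤ (η M B C) (weight-≥ w))

  weight-≥-from-every-vertex : ∀ {B D} (w : Walk M B D) →
                               All (λ V → size (V ∖ D) ≤ weight M w) (vertices M w)
  weight-≥-from-every-vertex w@([ _ ])           = weight-≥ w ∷ []
  weight-≥-from-every-vertex w@(_∷_ {B} {C} _ u) =
    weight-≥ w ∷ All.map (λ near → ≤-trans near (m≤n+m (weight M u) (η M B C)))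
                         (weight-≥-from-every-vertex u)

  edge-parity : ∀ {B C} → Adjacent M B C → 2 ∣ η M B C + (∣ proj₂ B ∣ + ∣ proj₂ C ∣)
  edge-parity {B} {C} ((_ , B-transversal) , (_ , C-transversal) , _)
    with transversal-tr {S = B} B-transversal | transversal-tr {S = C} C-transversal
  ... | s , refl | t , refl =
    subst (λ m → 2 ∣ m + (∣ s ∣ + ∣ t ∣)) (sym (size-tr-∖-tr s t)) (hamming-even s t)

  walk-parity : ∀ {B D} (w : Walk M B D) → 2 ∣ weight M w + (∣ proj₂ B ∣ + ∣ proj₂ D ∣)
  walk-parity ([_] {B} _) = 2∣m+m ∣ proj₂ B ∣
  walk-parity (_∷_ {B} {C} {D} e w) =
    2∣-chain (η M B C) (weight M w) (∣ proj₂ B ∣) (∣ proj₂ C ∣) (∣ proj₂ D ∣)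
             (edge-parity e) (walk-parity w)

  closed-walk-even : ∀ {B} (w : Walk M B B) → 2 ∣ weight M w
  closed-walk-even {B} w =
    ∣m+n∣m⇒∣n (subst (2 ∣_) (+-comm (weight M w) _) (walk-parity w)) (2∣m+m ∣ proj₂ B ∣)

  edge-positive : ∀ {B C} → Adjacent M B C → 0 < η M B C
  edge-positive (_ , _ , _ , inj₁ η≡1)       = ≤-reflexive (sym η≡1)
  edge-positive (_ , _ , _ , inj₂ (η≡2 , _)) = ≤-trans (s≤s z≤n) (≤-reflexive (sym η≡2))

  private
    distinct : ∀ {B C : Sub n} {m} → size (B ∖ C) ≡ suc m → B ≢ C
    distinct {B} η≡1+m refl with trans (sym (size-∖-self B)) η≡1+m
    ... | ()

  adjacent-by-1 : ∀ {B C} → Vertex M B → Vertex M C → size (B ∖ C) ≡ 1 → Adjacent M B C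
  adjacent-by-1 vB vC η≡1 = vB , vC , distinct η≡1 , inj₁ η≡1

  adjacent-by-2 : ∀ {B C A} → Vertex M B → Vertex M C → size (B ∖ C) ≡ 2 →
                  IsBasis A → IsAlmostTransversal n A → size (B ∖ A) ≡ 1 → size (C ∖ A) ≡ 1 →
                  Adjacent M B C
  adjacent-by-2 {A = A} vB vC η≡2 bA almost B∖A≡1 C∖A≡1 =
    vB , vC , distinct η≡2 , inj₂ (η≡2 , A , bA , almost , B∖A≡1 , C∖A≡1)

  basis-almost-transversal : ∀ {S} → IsBasis S → skews S ≡ 1 → IsAlmostTransversal n S
  basis-almost-transversal {S} bS skews≡1 with bases-shape S bS
  ... | inj₂ almost          = almost
  ... | inj₁ (_ , skews≡0) with trans (sym skews≡0) skews≡1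
  ...   | ()

  pairSwap-mirror-basis : ∀ s {i j} → j ≢ i →
                          IsBasis (pairSwap i j (tr s)) → IsBasis (pairSwap j i (tr s))
  pairSwap-mirror-basis s {i} {j} j≢i = Equivalence.to (B2 (tr s) (tr-transversal s) j i j≢i)

  record GeodesicStep (s s' : Subset n) : Set where
    field
      next         : Subset n
      basis        : IsBasis (tr next)
      adjacent     : Adjacent M (tr s) (tr next)
      next-between : Between s next s'

  step-within-pair : ∀ {s s' i} → IsBasis (tr s) → lookup s i ≢ lookup s' i →
    IsBasis (addE (i , lookup s' i) (delE (i , lookup s i) (tr s))) → GeodesicStep s s'
  step-within-pair {s} {s'} {i} bs sᵢ≢s'ᵢ b-exchanged = record
    { next         = q
    ; basis        = bq
    ; adjacent     = adjacent-by-1 (bs , tr-transversal s) (bq , tr-transversal q) η≡1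
    ; next-between = between-[]≔ (inj₂ refl) between-refl
    }
    where
    q = s [ i ]≔ lookup s' i
    bq : IsBasis (tr q)
    bq = subst IsBasis (exchange-within-pair s i (lookup s' i)) b-exchanged
    η≡1 : size (tr s ∖ tr q) ≡ 1
    η≡1 = trans (size-tr-∖-tr s q) (trans (hamming-[]≔ s i (lookup s' i)) (xor-≢ sᵢ≢s'ᵢ))

  second-exchange : ∀ s {i j y} → j ≢ i → lookup s j ≢ y → IsBasis (pairSwap i j (tr s)) →
                    ∃ λ d → IsBasis (tr (s [ i ]≔ d [ j ]≔ y))
  second-exchange s {i} {j} j≢i sⱼ≢y bA
    with Exch (pairSwap i j (tr s)) (pairSwap j i (tr s)) bA (pairSwap-mirror-basis s j≢i bA)
              (j , lookup s j) (∈E-pairSwap (tr s) (lookup s j) j≢i) (∉E-pairSwap (tr s) j i (lookup s j))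
              (skews-delE-pairSwap s i j (lookup s j)) (skews-addE-pairSwap s j≢i (lookup s j))
  ... | (k , d) , k,d∈ , k,d∉ , b-exchanged , _ with pairSwap-difference (tr s) k,d∈ k,d∉
  ...   | refl = d , subst IsBasis (exchange-out-of-pairSwap s j≢i d sⱼ≢y) b-exchanged

  step-across-pairs : ∀ {s s' i j} → IsBasis (tr s) → j ≢ i →
    lookup s i ≢ lookup s' i → lookup s j ≢ lookup s' j → IsBasis (pairSwap i j (tr s)) →
    GeodesicStep s s'
  step-across-pairs {s} {s'} {i} {j} bs j≢i sᵢ≢s'ᵢ sⱼ≢s'ⱼ bA = record
    { next         = q
    ; basis        = bq
    ; adjacent     = adjacent
    ; next-between = between-[]≔ (inj₂ refl) (between-[]≔ (bool-dichotomy sᵢ≢s'ᵢ d) between-refl)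
    }
    where
    d  = proj₁ (second-exchange s j≢i sⱼ≢s'ⱼ bA)
    bq = proj₂ (second-exchange s j≢i sⱼ≢s'ⱼ bA)
    q  = s [ i ]≔ d [ j ]≔ lookup s' j
    η≡ : size (tr s ∖ tr q) ≡ toℕ (lookup s i xor d) + 1
    η≡ = trans (size-tr-∖-tr s q)
               (trans (hamming-[]≔-[]≔ s d (lookup s' j) j≢i)
                      (cong (toℕ (lookup s i xor d) +_) (xor-≢ sⱼ≢s'ⱼ)))
    q≈s : ∀ k → k ≢ i → k ≢ j → lookup q k ≡ lookup s k
    q≈s k k≢i k≢j = trans (lookup∘update′ k≢j (s [ i ]≔ d) _) (lookup∘update′ k≢i s d)
    adjacent : Adjacent M (tr s) (tr q)
    adjacent = by-distance (Sum.map (trans η≡) (trans η≡) (toℕ+1≡1⊎2 (lookup s i xor d)))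
      where
      by-distance : size (tr s ∖ tr q) ≡ 1 ⊎ size (tr s ∖ tr q) ≡ 2 → Adjacent M (tr s) (tr q)
      by-distance (inj₁ η≡1) = adjacent-by-1 (bs , tr-transversal s) (bq , tr-transversal q) η≡1
      by-distance (inj₂ η≡2) = adjacent-by-2 (bs , tr-transversal s) (bq , tr-transversal q) η≡2
        bA (basis-almost-transversal bA (skews-pairSwap s j≢i))
        (size-tr-∖-pairSwap s j≢i s λ _ _ _ → refl) (size-tr-∖-pairSwap s j≢i q q≈s)

  geodesic-step : ∀ {s s' i} → IsBasis (tr s) → IsBasis (tr s') →
                  lookup s i ≢ lookup s' i → GeodesicStep s s'
  geodesic-step {s} {s'} {i} bs bs' sᵢ≢s'ᵢ
    with Exch (tr s) (tr s') bs bs' (i , lookup s i) (∈-tr s i) (∉-tr s' (≢-sym sᵢ≢s'ᵢ))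
              (skews-delE-tr s (i , lookup s i)) (skews-addE-tr s' (≢-sym sᵢ≢s'ᵢ))
  ... | (j , c) , j,c∈ , j,c∉ , b-exchanged , _ with ∈-tr⁻ s' j,c∈
  ...   | refl with j ≟ i
  ...     | yes refl = step-within-pair bs sᵢ≢s'ᵢ b-exchanged
  ...     | no j≢i   = step-across-pairs bs j≢i sᵢ≢s'ᵢ sⱼ≢s'ⱼ
                         (subst IsBasis (exchange-across-pairs s j≢i sⱼ≢s'ⱼ) b-exchanged)
    where
    sⱼ≢s'ⱼ = ∉-tr⁻ s j,c∉

  module _ {s' : Subset n} (bs' : IsBasis (tr s')) where

    geodesic : ∀ {s} → IsBasis (tr s) → Acc _<_ (hamming s s') →
               Σ (Walk M (tr s) (tr s')) λ w → IsPath M w × weight M w ≡ hamming s s'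
    geodesic {s} bs (acc closer-accessible) with ≡-dec Bool._≟_ s s'
    ... | yes refl = [ bs , tr-transversal s ] , [] ∷ [] , sym (hamming-self s)
    ... | no s≢s'  =
      adjacent ∷ w , All.map far-from-target (weight-≥-from-every-vertex w) ∷ w-path , weight≡
      where
      differing = ¬∀⟶∃¬ n _ (λ k → lookup s k Bool.≟ lookup s' k) (s≢s' ∘ ≡-lookup)
      open GeodesicStep (geodesic-step bs bs' (proj₂ differing))
      split : size (tr s ∖ tr next) + hamming next s' ≡ hamming s s'
      split = trans (cong (_+ hamming next s') (size-tr-∖-tr s next)) (hamming-between s next s' next-between)
      closer : hamming next s' < hamming s s'
      closer = subst (hamming next s' <_) split (m<n+m (hamming next s') (edge-positive adjacent))
      rest = geodesic basis (closer-accessible closer)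
      w = proj₁ rest
      w-path = proj₁ (proj₂ rest)
      weight≡ : weight M (adjacent ∷ w) ≡ hamming s s'
      weight≡ = trans (cong (size (tr s ∖ tr next) +_) (proj₂ (proj₂ rest))) split
      far-from-target : ∀ {V} → size (V ∖ tr s') ≤ weight M w → tr s ≢ V
      far-from-target near refl =
        <⇒≱ closer (subst₂ _≤_ (size-tr-∖-tr s s') (proj₂ (proj₂ rest)) near)

  distance : ∀ {B B'} → Vertex M B → Vertex M B' → IsDist M B B' (size (B ∖ B'))
  distance {B} {B'} (bB , B-transversal) (bB' , B'-transversal)
    with transversal-tr {S = B} B-transversal | transversal-tr {S = B'} B'-transversal
  ... | s , refl | s' , refl with geodesic bB' bB (<-wellFounded (hamming s s'))
  ...   | w , w-path , weight≡ =
    (w , w-path , trans weight≡ (sym (size-tr-∖-tr s s'))) , λ u _ → weight-≥ u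

-- Part (ii) holds for every closed walk.
lemma5p1 : (n : ℕ) (M : AntisymmetricMatroid n) →
    (∀ B B' → Vertex M B → Vertex M B' → IsDist M B B' (size (B ∖ B')))
    × (∀ B (C : Walk M B B) → IsCycle M C → 2 ∣ weight M C)
lemma5p1 n M = (λ _ _ → distance M) , λ _ C _ → closed-walk-even M C
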